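{- Let $w$ be a word with $s_1(w)=s_2(w)=2$, and let $sq_1,SQ_1$ (resp. $sq_2,SQ_2$) be the roots of the two squares whose last occurrence in $w$ starts at location 1 (resp. 2), with $|sq_1|<|SQ_1|$ and $|sq_2|<|SQ_2|$. Suppose $w$ is an unequal 2FS square, i.e., $|sq_1|<|SQ_1|<|sq_2|<|SQ_2|$. Then $|sq_2|>|SQ_1|+|sq_1|$.
   Context: A square is a word $uu$ with $u$ nonempty; $u$ is its root. A square $uu$ occurs at location $k$ of $w=a_1\cdots a_n$ if $a_k\cdots a_{k+2|u|-1}=uu$. $s_k(w)$ is the number of distinct squares occurring at location $k$ of $w$ but at no location $k'>k$. It is known that $s_k(w)\le 2$. -}

module Defs where

open import Level using (Lift)
open import Data.Empty using (⊥)
open import Data.List using (List; []; _∷_; _++_; drop; length)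
open import Data.Nat using (ℕ; zero; suc; _<_)
open import Data.Product using (∃; _×_)
open import Relation.Binary.PropositionalEquality using (_≡_)
open import Relation.Nullary using (¬_)

-- A word over an alphabet A is a List A; locations are 1-based as in the paper:
-- location k ≥ 1 of w = a₁⋯aₙ refers to the suffix a_k ⋯ a_n, i.e. drop (k - 1) w.
-- There is no location 0.

SquareAt : ∀ {a} {A : Set a} → List A → ℕ → List A → Set a
SquareAt w zero    u = Lift _ ⊥
SquareAt w (suc j) u = ¬ (u ≡ []) × ∃ λ rest → drop j w ≡ u ++ u ++ rest

LastSquareAt : ∀ {a} {A : Set a} → List A → ℕ → List A → Set a
LastSquareAt w k u = SquareAt w k u × (∀ k' → k < k' → ¬ SquareAt w k' u)

-- Write a = |sq₁|, b = |SQ₁|, c = |sq₂| and suppose c ≤ a + b; set q = c - b, p = b - a and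
-- s = a - q ≥ 0. The squares of roots SQ₁ (at 1) and sq₂ (at 2) force w[2 .. b] to have
-- period q, so it is read off a function T on ℤ/q. The square of root sq₁ adds that T is
-- invariant under +s on all residues but one, hence (following the orbit of +s) on all of
-- them, and under +p on an initial segment. If s ≤ p the prefix sq₁sq₁ reappears b letters
-- later, and if p < s the whole of w[1 .. 2c+1] has period q, so sq₁sq₁ reappears q letters
-- later; either way inside w, contradicting that the last occurrence of sq₁sq₁ is at 1.
module Submission where

open import Defs
open import Data.List using (List; length)
open import Data.Nat using (_<_; _+_)
open import Data.Product using (_×_)
open import Data.Sum using (_⊎_)
open import Relation.Binary.PropositionalEquality using (_≡_)

open import Data.Empty using (⊥-elim)
open import Data.List using ([]; _∷_; _++_; drop)
open import Data.List.Properties using (length-++; length-drop; ++-assoc)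
open import Data.Maybe using (Maybe; just; nothing)
open import Data.Maybe.Properties using (just-injective)
open import Data.Nat using (ℕ; zero; suc; _≤_; _*_; z≤n; s≤s; z<s; _<?_)
open import Data.Nat.Divisibility using (_∣_; divides; _∣?_; ∣-refl; ∣m+n∣m⇒∣n; m∣m*n)
open import Data.Nat.DivMod using (_%_; _/_; m≡m%n+[m/n]*n; [m+kn]%n≡m%n; m%n<n)
open import Data.Nat.Induction using (<-rec)
open import Data.Nat.Properties
open import Algebra.Properties.CommutativeSemigroup +-commutativeSemigroup
  using (xy∙z≈xz∙y; xy∙z≈x∙zy; x∙yz≈xz∙y; xy∙z≈y∙zx; xy∙z≈zx∙y)
open import Data.Nat.Tactic.RingSolver using (solve-∀)
open import Data.Product using (∃-syntax; _,_)
open import Data.Sum using (inj₁; inj₂)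
open import Function using (_∘_)
open import Relation.Binary.Definitions using (tri<; tri≈; tri>)
open import Relation.Binary.PropositionalEquality using (refl; sym; trans; cong; cong₂; subst; subst₂; module ≡-Reasoning)
open import Relation.Nullary using (¬_; yes; no)

open ≡-Reasoning

module Residues {ℓ} {B : Set ℓ} (g : ℕ → B) (q₀ : ℕ) where

  q : ℕ
  q = suc q₀

  T : ℕ → B
  T k = g (k % q)

  T-+* : ∀ n k → T (n + k * q) ≡ T n
  T-+* n k = cong g ([m+kn]%n≡m%n n k q)

  T-+q : ∀ n → T (n + q) ≡ T n
  T-+q n = trans (cong (λ m → T (n + m)) (sym (*-identityˡ q))) (T-+* n 1)

  T-+multiple : ∀ n {x} → q ∣ x → T (n + x) ≡ T n
  T-+multiple n (divides k refl) = T-+* n k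

  shift-from-residue : ∀ s m → T (m % q) ≡ T (m % q + s) → T m ≡ T (m + s)
  shift-from-residue s m inv = begin
    T m                        ≡⟨ cong T m≡r+nq ⟩
    T (r + n * q)              ≡⟨ T-+* r n ⟩
    T r                        ≡⟨ inv ⟩
    T (r + s)                  ≡⟨ T-+* (r + s) n ⟨
    T (r + s + n * q)          ≡⟨ cong T (xy∙z≈xz∙y r s (n * q)) ⟩
    T (r + n * q + s)          ≡⟨ cong (λ k → T (k + s)) m≡r+nq ⟨
    T (m + s)                  ∎
    where
    r = m % q
    n = m / q
    m≡r+nq = m≡m%n+[m/n]*n m q

  invariant-from-residues : ∀ s → (∀ r → r < q → T r ≡ T (r + s)) → ∀ m → T m ≡ T (m + s)
  invariant-from-residues s inv m = shift-from-residue s m (inv (m % q) (m%n<n m q))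

  module _ (s : ℕ) (inv : ∀ r → r < q₀ → T r ≡ T (r + s)) where

    invariant-off-last : ∀ m → ¬ q ∣ suc m → T m ≡ T (m + s)
    invariant-off-last m q∤1+m with m % q <? q₀
    ... | yes r<q₀ = shift-from-residue s m (inv (m % q) r<q₀)
    ... | no r≮q₀ = ⊥-elim (q∤1+m (divides (suc (m / q)) (cong suc m≡q₀+nq)))
      where
      m≡q₀+nq : m ≡ q₀ + m / q * q
      m≡q₀+nq = trans (m≡m%n+[m/n]*n m q)
        (cong (_+ m / q * q) (≤-antisym (≤-pred (m%n<n m q)) (≮⇒≥ r≮q₀)))

    -- Follow q₀ + s, q₀ + 2s, … until the first multiple of s divisible by q; every step
    -- before it leaves a residue other than q₀, so T is unchanged along the way.
    orbit : ∀ k → (∃[ j ] q ∣ j * s × T (q₀ + s) ≡ T (q₀ + j * s)) ⊎ T (q₀ + s) ≡ T (q₀ + suc k * s)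
    orbit zero = inj₂ (cong (λ m → T (q₀ + m)) (sym (*-identityˡ s)))
    orbit (suc k) with orbit k
    ... | inj₁ hit = inj₁ hit
    ... | inj₂ e with q ∣? suc k * s
    ...   | yes q∣ks = inj₁ (suc k , q∣ks , e)
    ...   | no q∤ks = inj₂ (trans e (trans (invariant-off-last (q₀ + suc k * s) (λ d → q∤ks (∣m+n∣m⇒∣n d ∣-refl)))
                              (cong T (xy∙z≈x∙zy q₀ (suc k * s) s))))

    invariant-at-last : T q₀ ≡ T (q₀ + s)
    invariant-at-last with orbit q₀
    ... | inj₁ (j , q∣js , e) = sym (trans e (T-+multiple q₀ q∣js))
    ... | inj₂ e = sym (trans e (T-+multiple q₀ (m∣m*n s)))

    invariant-everywhere : ∀ m → T m ≡ T (m + s)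
    invariant-everywhere = invariant-from-residues s residue-case
      where
      residue-case : ∀ r → r < q → T r ≡ T (r + s)
      residue-case r r<q with r <? q₀
      ... | yes r<q₀ = inv r r<q₀
      ... | no r≮q₀ rewrite ≤-antisym (≤-pred r<q) (≮⇒≥ r≮q₀) = invariant-at-last

module _ {ℓ} {B : Set ℓ} where

  IsSquare : (ℕ → B) → ℕ → ℕ → Set ℓ
  IsSquare f o n = ∀ i → i < n → f (o + i) ≡ f (o + i + n)

  Agree : (ℕ → B) → (ℕ → B) → ℕ → ℕ → Set ℓ
  Agree f g o n = ∀ i → i < n → f (o + i) ≡ g (o + i)

  RepeatsPrefix : (ℕ → B) → ℕ → ℕ → Set ℓ
  RepeatsPrefix f j n = ∀ i → i < n → f (j + i) ≡ f i

  agree-square : ∀ {f g o n} → IsSquare f o n → IsSquare g o n → Agree f g o n → Agree f g o (n + n)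
  agree-square {f} {g} {o} {n} f-sq g-sq f≈g i i<2n with i <? n
  ... | yes i<n = f≈g i i<n
  ... | no i≮n with m≤n⇒∃[o]m+o≡n (≮⇒≥ i≮n)
  ...   | k , refl = begin
    f (o + (n + k))  ≡⟨ cong f (x∙yz≈xz∙y o n k) ⟩
    f (o + k + n)    ≡⟨ f-sq k k<n ⟨
    f (o + k)        ≡⟨ f≈g k k<n ⟩
    g (o + k)        ≡⟨ g-sq k k<n ⟩
    g (o + k + n)    ≡⟨ cong g (x∙yz≈xz∙y o n k) ⟨
    g (o + (n + k))  ∎
    where
    k<n : k < n
    k<n = +-cancelˡ-< n k n i<2n

-- Positions are 0-based here, so the square of root sq₂ (length c) starts at position 1.
module ThreeSquares {ℓ} {B : Set ℓ} (f : ℕ → B) (q₀ p₀ s : ℕ) where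

  q p a b c : ℕ
  q = suc q₀
  p = suc p₀
  a = q + s
  b = a + p
  c = b + q

  open Residues (f ∘ suc) q₀ using (T; T-+q; invariant-from-residues; invariant-everywhere)

  a<b : a < b
  a<b = m<m+n a z<s

  b<c : b < c
  b<c = m<m+n b z<s

  q<b : q < b
  q<b = ≤-<-trans (m≤m+n q s) a<b

  b+2a≤1+2c : s ≤ p → b + (a + a) ≤ suc (c + c)
  b+2a≤1+2c s≤p = subst₂ _≤_ (sym (left q p s)) (right q p s)
    (≤-trans (+-monoʳ-≤ (q + q + q + s + s + p) s≤p) (m≤m+n _ (suc q)))
    where
    left : ∀ q p s → q + s + p + (q + s + (q + s)) ≡ q + q + q + s + s + p + s
    left = solve-∀
    right : ∀ q p s → q + q + q + s + s + p + p + suc q ≡ suc (q + s + p + q + (q + s + p + q))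
    right = solve-∀

  q+2a≤1+2c : q + (a + a) ≤ suc (c + c)
  q+2a≤1+2c = subst (q + (a + a) ≤_) (sym (split q p s)) (m≤m+n _ _)
    where
    split : ∀ q p s → suc (q + s + p + q + (q + s + p + q)) ≡ q + (q + s + (q + s)) + suc (q + p + p)
    split = solve-∀

  module _ (a-square : IsSquare f 0 a) (b-square : IsSquare f 0 b) (c-square : IsSquare f 1 c) where

    f-q-periodic-prefix : ∀ k → suc k + q < b → f (suc k) ≡ f (suc k + q)
    f-q-periodic-prefix k h = begin
      f (suc k)          ≡⟨ c-square k (<-trans (<-trans (m≤m+n (suc k) q) h) b<c) ⟩
      f (suc k + c)      ≡⟨ cong f (x∙yz≈xz∙y (suc k) b q) ⟩
      f (suc k + q + b)  ≡⟨ b-square (suc k + q) h ⟨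
      f (suc k + q)      ∎

    f-prefix-repeats : ∀ n r → suc (r + n * q) < b → f (suc (r + n * q)) ≡ f (suc r)
    f-prefix-repeats zero r _ = cong (f ∘ suc) (+-identityʳ r)
    f-prefix-repeats (suc n) r h = begin
      f (suc (r + suc n * q))  ≡⟨ cong (f ∘ suc) (x∙yz≈xz∙y r q (n * q)) ⟩
      f (suc (r + n * q) + q)  ≡⟨ f-q-periodic-prefix (r + n * q) h′ ⟨
      f (suc (r + n * q))      ≡⟨ f-prefix-repeats n r (≤-<-trans (m≤m+n (suc (r + n * q)) q) h′) ⟩
      f (suc r)                ∎
      where
      h′ : suc (r + n * q) + q < b
      h′ = subst (λ m → suc m < b) (x∙yz≈xz∙y r q (n * q)) h

    f≡T : ∀ k → suc k < b → f (suc k) ≡ T k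
    f≡T k h = trans (cong (f ∘ suc) k≡r+nq) (f-prefix-repeats (k / q) (k % q) (subst (λ m → suc m < b) k≡r+nq h))
      where
      k≡r+nq = m≡m%n+[m/n]*n k q

    T[q₀+s]≡f0 : T (q₀ + s) ≡ f 0
    T[q₀+s]≡f0 = trans (sym (f≡T (q₀ + s) a<b)) (sym (a-square 0 z<s))

    T[p₀]≡f0 : p < a → T p₀ ≡ f 0
    T[p₀]≡f0 p<a = begin
      T p₀       ≡⟨ f≡T p₀ (<-trans p<a a<b) ⟨
      f p        ≡⟨ a-square p p<a ⟩
      f (p + a)  ≡⟨ cong f (+-comm p a) ⟩
      f b        ≡⟨ b-square 0 z<s ⟨
      f 0        ∎

    T-p-periodic-below : ∀ k → suc (p + k) < a → T (p + k) ≡ T k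
    T-p-periodic-below k h = begin
      T (p + k)            ≡⟨ f≡T (p + k) (<-trans h a<b) ⟨
      f (suc (p + k))      ≡⟨ a-square (suc (p + k)) h ⟩
      f (suc (p + k) + a)  ≡⟨ cong (f ∘ suc) (xy∙z≈y∙zx p k a) ⟩
      f (suc k + b)        ≡⟨ b-square (suc k) 1+k<b ⟨
      f (suc k)            ≡⟨ f≡T k 1+k<b ⟩
      T k                  ∎
      where
      1+k<b : suc k < b
      1+k<b = ≤-<-trans (s≤s (m≤n+m k p)) (<-trans h a<b)

    s-invariant-below-p₀ : p < a → ∀ k → k < p₀ → T k ≡ T (k + s)
    s-invariant-below-p₀ p<a k k<p₀ = begin
      T k            ≡⟨ f≡T k (<-trans (s≤s k<p₀) (<-trans p<a a<b)) ⟨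
      f (suc k)      ≡⟨ a-square (suc k) (<-trans (s≤s k<p₀) p<a) ⟩
      f (suc k + a)  ≡⟨ f≡T (k + a) (subst (suc k + a <_) (+-comm p a) (+-monoˡ-< a (s≤s k<p₀))) ⟩
      T (k + a)      ≡⟨ cong T (x∙yz≈xz∙y k q s) ⟩
      T (k + s + q)  ≡⟨ T-+q (k + s) ⟩
      T (k + s)      ∎

    s-invariant-at-p₀ : p < a → p₀ < q₀ → T p₀ ≡ T (p₀ + s)
    s-invariant-at-p₀ p<a p₀<q₀ with 0 <? s
    ... | no s≮0 = cong T (trans (sym (+-identityʳ p₀)) (cong (p₀ +_) (sym (n≤0⇒n≡0 (≮⇒≥ s≮0)))))
    ... | yes 0<s with m≤n⇒∃[o]m+o≡n 0<s
    ...   | s₀ , 1+s₀≡s = begin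
      T p₀                ≡⟨ T[p₀]≡f0 p<a ⟩
      f 0                 ≡⟨ T[q₀+s]≡f0 ⟨
      T (q₀ + s)          ≡⟨ cong (λ t → T (q₀ + t)) s≡ ⟩
      T (q₀ + suc s₀)     ≡⟨ cong T (trans (+-suc q₀ s₀) (+-comm q s₀)) ⟩
      T (s₀ + q)          ≡⟨ T-+q s₀ ⟩
      T s₀                ≡⟨ T-p-periodic-below s₀ bound ⟨
      T (p + s₀)          ≡⟨ cong T (+-suc p₀ s₀) ⟨
      T (p₀ + suc s₀)     ≡⟨ cong (λ t → T (p₀ + t)) s≡ ⟨
      T (p₀ + s)          ∎
      where
      s≡ : s ≡ suc s₀
      s≡ = sym 1+s₀≡s
      bound : suc (p + s₀) < a
      bound = subst (λ x → suc x < a) (trans (cong (p₀ +_) s≡) (+-suc p₀ s₀)) (s≤s (+-monoˡ-< s p₀<q₀))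

    s-invariant-below-q₀ : p < a → ∀ m → m < q₀ → T m ≡ T (m + s)
    s-invariant-below-q₀ p<a = <-rec (λ m → m < q₀ → T m ≡ T (m + s)) step
      where
      step : ∀ m → (∀ {k} → k < m → k < q₀ → T k ≡ T (k + s)) → m < q₀ → T m ≡ T (m + s)
      step m ih m<q₀ with <-cmp m p₀
      ... | tri< m<p₀ _ _ = s-invariant-below-p₀ p<a m m<p₀
      ... | tri≈ _ refl _ = s-invariant-at-p₀ p<a m<q₀
      ... | tri> _ _ p₀<m with m≤n⇒∃[o]m+o≡n p₀<m
      ...   | k , refl = begin
        T (p + k)        ≡⟨ T-p-periodic-below k (<-≤-trans (s≤s m<q₀) (m≤m+n q s)) ⟩
        T k              ≡⟨ ih k<m (<-trans k<m m<q₀) ⟩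
        T (k + s)        ≡⟨ T-p-periodic-below (k + s) m+s<a ⟨
        T (p + (k + s))  ≡⟨ cong T (+-assoc p k s) ⟨
        T (p + k + s)    ∎
        where
        k<m : k < p + k
        k<m = m<n+m k z<s
        m+s<a : suc (p + (k + s)) < a
        m+s<a = subst (λ x → suc x < a) (+-assoc p k s) (s≤s (+-monoˡ-< s m<q₀))

    s-invariant : p < a → ∀ m → T m ≡ T (m + s)
    s-invariant p<a = invariant-everywhere s (s-invariant-below-q₀ p<a)

    -- Past b the letter at b + (b + k) is read back through the c-square at position
    -- p + k + s, and s-invariance of T carries it to p + k, which the a-square sends to b + k.
    shift-by-b : s ≤ p → RepeatsPrefix f b (a + a)
    shift-by-b s≤p i i<2a with i <? b
    ... | yes i<b = trans (cong f (+-comm b i)) (sym (b-square i i<b))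
    ... | no i≮b with m≤n⇒∃[o]m+o≡n (≮⇒≥ i≮b)
    ...   | k , refl = begin
      f (b + (b + k))      ≡⟨ cong f (via-c q p s k) ⟨
      f (p + k + s + c)    ≡⟨ c-square (p₀ + k + s) p₀+k+s<c ⟨
      f (p + k + s)        ≡⟨ f≡T (p₀ + k + s) p+k+s<b ⟩
      T (p₀ + k + s)       ≡⟨ s-invariant p<a (p₀ + k) ⟨
      T (p₀ + k)           ≡⟨ f≡T (p₀ + k) (<-trans p+k<a a<b) ⟨
      f (p + k)            ≡⟨ a-square (p + k) p+k<a ⟩
      f (p + k + a)        ≡⟨ cong f (xy∙z≈zx∙y p k a) ⟩
      f (b + k)            ∎
      where
      via-c : ∀ q p s k → p + k + s + (q + s + p + q) ≡ q + s + p + (q + s + p + k)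
      via-c = solve-∀
      p+k<a : p + k < a
      p+k<a = +-cancelˡ-< a (p + k) a (subst (_< a + a) (+-assoc a p k) i<2a)
      p<a : p < a
      p<a = ≤-<-trans (m≤m+n p k) p+k<a
      k<q : k < q
      k<q = +-cancelˡ-< p k q (<-≤-trans p+k<a (≤-trans (+-monoʳ-≤ q s≤p) (≤-reflexive (+-comm q p))))
      p+k+s<b : p + k + s < b
      p+k+s<b = subst (p + k + s <_) (trans (xy∙z≈y∙zx p q s) (sym (+-assoc q s p))) (+-monoˡ-< s (+-monoʳ-< p k<q))
      p₀+k+s<c : p₀ + k + s < c
      p₀+k+s<c = <-trans (≤-<-trans (n≤1+n _) p+k+s<b) b<c

    module _ (p<s : p < s) where

      p<a : p < a
      p<a = <-≤-trans p<s (m≤n+m s q)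

      T-p-periodic : ∀ k → T (p + k) ≡ T k
      T-p-periodic k = trans (cong T (+-comm p k)) (sym (invariant-from-residues p residue-case k))
        where
        residue-case : ∀ r → r < q → T r ≡ T (r + p)
        residue-case r r<q = trans (sym (T-p-periodic-below r bound)) (cong T (+-comm p r))
          where
          bound : suc (p + r) < a
          bound = subst₂ _≤_ (cong suc (+-suc p r)) (+-comm s q) (+-mono-≤ p<s r<q)

      T-b-periodic : ∀ k → T (k + b) ≡ T k
      T-b-periodic k = begin
        T (k + b)          ≡⟨ cong T (reorder k q s p) ⟩
        T (k + p + s + q)  ≡⟨ T-+q (k + p + s) ⟩
        T (k + p + s)      ≡⟨ s-invariant p<a (k + p) ⟨
        T (k + p)          ≡⟨ cong T (+-comm k p) ⟩
        T (p + k)          ≡⟨ T-p-periodic k ⟩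
        T k                ∎
        where
        reorder : ∀ k q s p → k + (q + s + p) ≡ k + p + s + q
        reorder = solve-∀

      -- model i is T (i - 1), read modulo q.
      model : ℕ → B
      model i = T (q₀ + i)

      model-+q : ∀ i → model (i + q) ≡ model i
      model-+q i = trans (cong T (sym (+-assoc q₀ i q))) (T-+q (q₀ + i))

      model-+b : ∀ i → model (i + b) ≡ model i
      model-+b i = trans (cong T (sym (+-assoc q₀ i b))) (T-b-periodic (q₀ + i))

      model-b-square : IsSquare model 0 b
      model-b-square i _ = sym (model-+b i)

      model-c-square : IsSquare model 1 c
      model-c-square i _ = sym (begin
        model (suc i + (b + q))  ≡⟨ cong model (+-assoc (suc i) b q) ⟨
        model (suc i + b + q)    ≡⟨ model-+q (suc i + b) ⟩
        model (suc i + b)        ≡⟨ model-+b (suc i) ⟩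
        model (suc i)            ∎)

      f≈model-below-b : Agree f model 0 b
      f≈model-below-b zero _ = begin
        f 0         ≡⟨ T[q₀+s]≡f0 ⟨
        T (q₀ + s)  ≡⟨ s-invariant p<a q₀ ⟨
        T q₀        ≡⟨ cong T (+-identityʳ q₀) ⟨
        model 0     ∎
      f≈model-below-b (suc k) 1+k<b = begin
        f (suc k)         ≡⟨ f≡T k 1+k<b ⟩
        T k               ≡⟨ T-+q k ⟨
        T (k + q)         ≡⟨ cong T (trans (+-suc q₀ k) (+-comm q k)) ⟨
        model (suc k)     ∎

      f≈model : Agree f model 0 (suc (c + c))
      f≈model zero _ = f≈model-below-b 0 z<s
      f≈model (suc i) 1+i<1+2c = agree-square {f = f} {model} {1} {c} c-square model-c-square f≈model-on-c i (≤-pred 1+i<1+2c)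
        where
        f≈model-on-c : Agree f model 1 c
        f≈model-on-c i i<c = agree-square {f = f} {model} {0} {b} b-square model-b-square f≈model-below-b (suc i) (≤-<-trans i<c (+-monoʳ-< b q<b))

      shift-by-q : RepeatsPrefix f q (a + a)
      shift-by-q i i<2a = begin
        f (q + i)      ≡⟨ f≈model (q + i) q+i<1+2c ⟩
        model (q + i)  ≡⟨ cong model (+-comm q i) ⟩
        model (i + q)  ≡⟨ model-+q i ⟩
        model i        ≡⟨ f≈model i (≤-<-trans (m≤n+m i q) q+i<1+2c) ⟨
        f i            ∎
        where
        q+i<1+2c : q + i < suc (c + c)
        q+i<1+2c = <-≤-trans (+-monoʳ-< q i<2a) q+2a≤1+2c

    prefix-recurs : ∃[ j ] 1 ≤ j × j + (a + a) ≤ suc (c + c) × RepeatsPrefix f j (a + a)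
    prefix-recurs with p <? s
    ... | yes p<s = q , s≤s z≤n , q+2a≤1+2c , shift-by-q p<s
    ... | no p≮s = b , s≤s z≤n , b+2a≤1+2c (≮⇒≥ p≮s) , shift-by-b (≮⇒≥ p≮s)

<-offset : ∀ {m n} → m < n → ∃[ d ] n ≡ m + suc d
<-offset {m} m<n with m≤n⇒∃[o]m+o≡n m<n
... | d , refl = d , sym (+-suc m d)

prefix-square-recurs : ∀ {ℓ} {B : Set ℓ} (f : ℕ → B) {a b c} → a < b → b < c → c ≤ b + a →
  IsSquare f 0 a → IsSquare f 0 b → IsSquare f 1 c →
  ∃[ j ] 1 ≤ j × j + (a + a) ≤ suc (c + c) × RepeatsPrefix f j (a + a)
prefix-square-recurs f {a} {b} a<b b<c c≤b+a with <-offset a<b | <-offset b<c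
... | p₀ , refl | q₀ , refl with m≤n⇒∃[o]m+o≡n (+-cancelˡ-≤ (a + suc p₀) (suc q₀) a c≤b+a)
...   | s , refl = ThreeSquares.prefix-recurs f q₀ p₀ s

module _ {ℓ} {A : Set ℓ} where

  at : List A → ℕ → Maybe A
  at []       _       = nothing
  at (x ∷ _)  zero    = just x
  at (_ ∷ xs) (suc i) = at xs i

  at-drop : ∀ j (w : List A) i → at (drop j w) i ≡ at w (j + i)
  at-drop zero    w       i = refl
  at-drop (suc j) []      i = refl
  at-drop (suc j) (_ ∷ w) i = at-drop j w i

  at-++ˡ : ∀ (u v : List A) {i} → i < length u → at (u ++ v) i ≡ at u i
  at-++ˡ (_ ∷ u) v {zero}  _   = refl
  at-++ˡ (_ ∷ u) v {suc i} i<n = at-++ˡ u v (≤-pred i<n)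

  at-++ʳ : ∀ (u v : List A) i → at (u ++ v) (length u + i) ≡ at v i
  at-++ʳ []      v i = refl
  at-++ʳ (_ ∷ u) v i = at-++ʳ u v i

  at-agree⇒prefix : ∀ (xs ys : List A) → length ys ≤ length xs →
    (∀ i → i < length ys → at xs i ≡ at ys i) → xs ≡ ys ++ drop (length ys) xs
  at-agree⇒prefix xs       []       _         _     = refl
  at-agree⇒prefix (x ∷ xs) (y ∷ ys) (s≤s len) agree =
    cong₂ _∷_ (just-injective (agree 0 z<s)) (at-agree⇒prefix xs ys len (λ i → agree (suc i) ∘ s≤s))

  square-fits : ∀ j (w : List A) {u r} → ¬ u ≡ [] → drop j w ≡ u ++ u ++ r → j + (length u + length u) ≤ length w
  square-fits zero w {u} {r} _ refl = subst (length u + length u ≤_) (sym |uur|) (+-monoʳ-≤ (length u) (m≤m+n (length u) (length r)))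
    where
    |uur| : length (u ++ u ++ r) ≡ length u + (length u + length r)
    |uur| = trans (length-++ u) (cong (length u +_) (length-++ u))
  square-fits (suc j) []      {[]}    u≢[] _ = ⊥-elim (u≢[] refl)
  square-fits (suc j) []      {_ ∷ _} _    ()
  square-fits (suc j) (_ ∷ w)         u≢[] e = s≤s (square-fits j w u≢[] e)

  SquareAt⇒fits : ∀ w j {u} → SquareAt w (suc j) u → j + (length u + length u) ≤ length w
  SquareAt⇒fits w j (u≢[] , _ , e) = square-fits j w u≢[] e

  SquareAt⇒IsSquare : ∀ w j {u} → SquareAt w (suc j) u → IsSquare (at w) j (length u)
  SquareAt⇒IsSquare w j {u} (_ , r , e) i i<n = begin
    at w (j + i)                     ≡⟨ at-drop j w i ⟨
    at (drop j w) i                  ≡⟨ cong (λ v → at v i) e ⟩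
    at (u ++ u ++ r) i               ≡⟨ at-++ˡ u (u ++ r) i<n ⟩
    at u i                           ≡⟨ at-++ˡ u r i<n ⟨
    at (u ++ r) i                    ≡⟨ at-++ʳ u (u ++ r) i ⟨
    at (u ++ u ++ r) (length u + i)  ≡⟨ cong (λ v → at v (length u + i)) e ⟨
    at (drop j w) (length u + i)     ≡⟨ at-drop j w (length u + i) ⟩
    at w (j + (length u + i))        ≡⟨ cong (at w) (x∙yz≈xz∙y j (length u) i) ⟩
    at w (j + i + length u)          ∎

  RepeatsPrefix⇒SquareAt : ∀ {w j u} → SquareAt w 1 u → j + (length u + length u) ≤ length w →
    RepeatsPrefix (at w) j (length u + length u) → SquareAt w (suc j) u
  RepeatsPrefix⇒SquareAt {w} {j} {u} (u≢[] , r , w≡uur) fits repeats =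
    u≢[] , drop (length (u ++ u)) (drop j w) , trans (at-agree⇒prefix (drop j w) (u ++ u) |uu|≤ agree) (++-assoc u u _)
    where
    |uu| : length (u ++ u) ≡ length u + length u
    |uu| = length-++ u
    |uu|≤ : length (u ++ u) ≤ length (drop j w)
    |uu|≤ = subst₂ _≤_ (sym |uu|) (sym (length-drop j w)) (m+n≤o⇒m≤o∸n _ (subst (_≤ length w) (+-comm j _) fits))
    agree : ∀ i → i < length (u ++ u) → at (drop j w) i ≡ at (u ++ u) i
    agree i i<|uu| = begin
      at (drop j w) i       ≡⟨ at-drop j w i ⟩
      at w (j + i)          ≡⟨ repeats i (subst (i <_) |uu| i<|uu|) ⟩
      at w i                ≡⟨ cong (λ v → at v i) w≡uur ⟩
      at (u ++ u ++ r) i    ≡⟨ cong (λ v → at v i) (++-assoc u u r) ⟨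
      at ((u ++ u) ++ r) i  ≡⟨ at-++ˡ (u ++ u) r i<|uu| ⟩
      at (u ++ u) i         ∎

lemma12 : ∀ {a} {A : Set a} (w sq₁ SQ₁ sq₂ SQ₂ : List A) →
    LastSquareAt w 1 sq₁ → LastSquareAt w 1 SQ₁ →
    (∀ u → LastSquareAt w 1 u → u ≡ sq₁ ⊎ u ≡ SQ₁) →
    LastSquareAt w 2 sq₂ → LastSquareAt w 2 SQ₂ →
    (∀ u → LastSquareAt w 2 u → u ≡ sq₂ ⊎ u ≡ SQ₂) →
    length sq₁ < length SQ₁ → length SQ₁ < length sq₂ → length sq₂ < length SQ₂ →
    length SQ₁ + length sq₁ < length sq₂
lemma12 w sq₁ SQ₁ sq₂ SQ₂ (sq₁-at-1 , sq₁-not-later) (SQ₁-at-1 , _) _ (sq₂-at-2 , _) _ _ a<b b<c _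
  with length SQ₁ + length sq₁ <? length sq₂
... | yes b+a<c = b+a<c
... | no b+a≮c
  with prefix-square-recurs (at w) a<b b<c (≮⇒≥ b+a≮c)
         (SquareAt⇒IsSquare w 0 sq₁-at-1) (SquareAt⇒IsSquare w 0 SQ₁-at-1) (SquareAt⇒IsSquare w 1 sq₂-at-2)
...   | j , 1≤j , fits , repeats =
  ⊥-elim (sq₁-not-later (suc j) (s≤s 1≤j)
    (RepeatsPrefix⇒SquareAt sq₁-at-1 (≤-trans fits (SquareAt⇒fits w 1 sq₂-at-2)) repeats))
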